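{- Let $\mathsf{X}\subseteq\mathsf{P}$ be finite. For a property $\mathcal{P}=\{t_1,\dots,t_n\}\neq\emptyset$ over $\mathsf{X}$, let $$\chi^{\mathsf{X},\mathbb{U}}_{\mathcal{P}}:=\bigwedge_{v_1\in t_1,\dots,v_n\in t_n}\Diamond_e\big(\chi^{\mathsf{X}}_{v_1}\curlyvee\cdots\curlyvee\chi^{\mathsf{X}}_{v_n}\big).$$ Then for any $t\subseteq 2^{\mathsf{X}}$, $t\vDash\chi^{\mathsf{X},\mathbb{U}}_{\mathcal{P}}$ iff there is $t_i\in\mathcal{P}$ with $t\supseteq t_i$.
   Context: Propositional team semantics: teams over $\mathsf{X}$ are sets $t\subseteq 2^{\mathsf{X}}$ of valuations. $t\vDash\Diamond_e\phi$ ("epistemic might") iff there is a nonempty $s\subseteq t$ with $s\vDash\phi$. $\alpha\curlyvee\beta:=\neg(\neg\alpha\wedge\neg\beta)$ for classical formulas, which are flat and evaluated classically on each valuation. For a valuation $v$, $\chi^{\mathsf{X}}_v:=\bigwedge\{p: p\in\mathsf{X},v(p)=1\}\wedge\bigwedge\{\neg p: p\in\mathsf{X},v(p)=0\}$, so for $w\in 2^{\mathsf{X}}$, $w\vDash\chi^{\mathsf{X}}_v$ iff $w=v$. Empty conjunction is $\top$. A property over $\mathsf{X}$ is a class of teams over $\mathsf{X}$. -}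

module Defs where

open import Level using (Level; 0ℓ) renaming (suc to lsuc)
open import Data.Nat using (ℕ)
open import Data.Bool using (Bool; true; false)
open import Data.Fin using (Fin)
open import Data.Vec using (Vec; lookup)
open import Data.List using (List; []; _∷_; map; concatMap; allFin)
open import Data.Product using (Σ; ∃; _×_; _,_)
open import Data.Empty using (⊥)
open import Data.Unit using (⊤)
open import Relation.Nullary using (¬_)
open import Relation.Binary.PropositionalEquality using (_≡_)
open import Data.List.Membership.Propositional using (_∈_)

-- Propositional variables X = {p_0,…,p_{k-1}} (a finite set of size k).
-- Valuations over X: 2^X, represented as bit vectors.
Val : ℕ → Set
Val k = Vec Bool k

Team : ℕ → Set₁
Team k = Val k → Set

data CForm (k : ℕ) : Set where
  atom : Fin k → CForm k
  ctop : CForm k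
  cneg : CForm k → CForm k
  cand : CForm k → CForm k → CForm k

data Form (k : ℕ) : Set where
  cl   : CForm k → Form k
  top  : Form k
  and  : Form k → Form k → Form k
  dia  : Form k → Form k

_⊩_ : ∀ {k} → Val k → CForm k → Set
v ⊩ atom i   = lookup v i ≡ true
v ⊩ ctop     = ⊤
v ⊩ cneg α   = ¬ (v ⊩ α)
v ⊩ cand α β = (v ⊩ α) × (v ⊩ β)

_⊨_ : ∀ {k} → Team k → Form k → Set₁
t ⊨ cl α    = Level.Lift _ (∀ v → t v → v ⊩ α)
t ⊨ top     = Level.Lift _ ⊤
t ⊨ and φ ψ = (t ⊨ φ) × (t ⊨ ψ)
t ⊨ dia φ   = Σ (Team _) λ s → (∀ v → s v → t v) × (∃ λ v → s v) × (s ⊨ φ)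

_⋎_ : ∀ {k} → CForm k → CForm k → CForm k
α ⋎ β = cneg (cand (cneg α) (cneg β))

-- Iterated ⋎ of a list α₁ ⋎ (α₂ ⋎ … ⋎ αₙ) (only used on nonempty lists;
-- the empty case is ¬⊤ for totality).
bigOr : ∀ {k} → List (CForm k) → CForm k
bigOr []           = cneg ctop
bigOr (α ∷ [])     = α
bigOr (α ∷ β ∷ αs) = α ⋎ bigOr (β ∷ αs)

bigAnd : ∀ {k} → List (Form k) → Form k
bigAnd []       = top
bigAnd (φ ∷ []) = φ
bigAnd (φ ∷ φs) = and φ (bigAnd φs)

chiLits : ∀ {k} → Val k → List (Fin k) → CForm k
chiLits v []       = ctop
chiLits v (i ∷ is) = cand (lit (lookup v i)) (chiLits v is)
  where
  lit : Bool → CForm _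
  lit true  = atom i
  lit false = cneg (atom i)

chi : ∀ {k} → Val k → CForm k
chi {k} v = chiLits v (allFin k)

choices : ∀ {A : Set} → List (List A) → List (List A)
choices []         = [] ∷ []
choices (xs ∷ xss) = concatMap (λ x → map (x ∷_) (choices xss)) xs

toTeam : ∀ {k} → List (Val k) → Team k
toTeam l v = v ∈ l

-- χ^{X,U}_P for P = {t₁,…,tₙ} given as the list of listed teams.
chiU : ∀ {k} → List (List (Val k)) → Form k
chiU ts = bigAnd (map (λ vs → dia (cl (bigOr (map chi vs)))) (choices ts))

-- Unfolding the semantics, t ⊨ ◇(χ_{v₁} ⋎ ⋯ ⋎ χ_{vₙ}) says exactly that t meets
-- {v₁,…,vₙ}: classical formulas are flat, so the witnessing subteam may be a
-- singleton, and χ_w holds only at w. Hence t ⊨ χ^{X,U}_P says that t meets every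
-- choice set of t₁,…,tₙ, and by distributivity of ∧ over ∨ (a finite, hence
-- constructive, argument) this happens iff t contains some tᵢ.
module Submission where

open import Defs
open import Level using (Level; lift)
open import Data.Nat using (ℕ)
open import Data.Bool using (true; false)
open import Data.Bool.Properties using (not-¬; ¬-not) renaming (_≟_ to _≟ᵇ_)
open import Data.Fin using (Fin)
open import Data.Vec using (lookup; tabulate)
open import Data.Vec.Properties using (≡-dec; tabulate∘lookup; tabulate-cong)
open import Data.List using (List; []; _∷_; map; allFin)
open import Data.List.Membership.Propositional using (_∈_; _∉_; find; lose)
open import Data.List.Membership.Propositional.Properties using (∈-map⁺; ∈-allFin)
open import Data.List.Relation.Unary.All as All using (All; []; _∷_)
open import Data.List.Relation.Unary.All.Properties using (map⁺; map⁻; concat⁺; concat⁻)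
open import Data.List.Relation.Unary.Any as Any using (Any; here; there)
open import Data.Product using (Σ; ∃; _×_; _,_)
open import Data.Sum using (_⊎_; inj₁; inj₂; swap)
open import Data.Unit using (tt)
open import Function using (_∘_)
open import Function.Bundles using (_⇔_; mk⇔; Equivalence)
open import Function.Related.Propositional using (module EquationalReasoning)
open import Relation.Nullary using (¬_)
open import Relation.Nullary.Decidable using (decidable-stable)
open import Relation.Binary.PropositionalEquality
  using (_≡_; _≢_; refl; sym; trans; subst; module ≡-Reasoning)
open import Relation.Unary using (Pred)

open Equivalence using (to; from)

private
  variable
    k : ℕ

≗-lookup⇒≡ : {v w : Val k} → (∀ i → lookup v i ≡ lookup w i) → v ≡ w
≗-lookup⇒≡ {v = v} {w} v≗w = begin
  v                   ≡⟨ sym (tabulate∘lookup v) ⟩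
  tabulate (lookup v) ≡⟨ tabulate-cong v≗w ⟩
  tabulate (lookup w) ≡⟨ tabulate∘lookup w ⟩
  w                   ∎
  where open ≡-Reasoning

⊩-chiLits⁺ : {v w : Val k} {is : List (Fin k)} →
  All (λ i → lookup w i ≡ lookup v i) is → w ⊩ chiLits v is
⊩-chiLits⁺ [] = tt
⊩-chiLits⁺ {v = v} {is = i ∷ _} (wᵢ≡vᵢ ∷ rest) with lookup v i
... | true  = wᵢ≡vᵢ , ⊩-chiLits⁺ rest
... | false = not-¬ wᵢ≡vᵢ , ⊩-chiLits⁺ rest

⊩-chiLits⁻ : {v w : Val k} {is : List (Fin k)} →
  w ⊩ chiLits v is → All (λ i → lookup w i ≡ lookup v i) is
⊩-chiLits⁻ {is = []} _ = []
⊩-chiLits⁻ {v = v} {is = i ∷ _} (wᵢ , rest) with lookup v i in vᵢ≡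
... | true  = trans wᵢ (sym vᵢ≡) ∷ ⊩-chiLits⁻ rest
... | false = trans (¬-not wᵢ) (sym vᵢ≡) ∷ ⊩-chiLits⁻ rest

⊩-chi⇔≡ : {v w : Val k} → w ⊩ chi v ⇔ w ≡ v
⊩-chi⇔≡ {k} = mk⇔
  (λ w⊩χᵥ → ≗-lookup⇒≡ (λ i → All.lookup (⊩-chiLits⁻ w⊩χᵥ) (∈-allFin i)))
  (λ { refl → ⊩-chiLits⁺ (All.universal (λ _ → refl) (allFin k)) })

⊩-bigOr⁺ : {v : Val k} {α : CForm k} {αs : List (CForm k)} →
  α ∈ αs → v ⊩ α → v ⊩ bigOr αs
⊩-bigOr⁺ {αs = _ ∷ []}    (here refl) v⊩α = v⊩α
⊩-bigOr⁺ {αs = _ ∷ _ ∷ _} (here refl) v⊩α = λ (v⊮α , _) → v⊮α v⊩α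
⊩-bigOr⁺ {αs = _ ∷ _ ∷ _} (there α∈) v⊩α = λ (_ , v⊮rest) → v⊮rest (⊩-bigOr⁺ α∈ v⊩α)

⊩-bigOr⇒¬All¬ : {v : Val k} {αs : List (CForm k)} →
  v ⊩ bigOr αs → ¬ All (λ α → ¬ v ⊩ α) αs
⊩-bigOr⇒¬All¬ {αs = []}        v⊩⊥ []             = v⊩⊥ tt
⊩-bigOr⇒¬All¬ {αs = _ ∷ []}    v⊩α (v⊮α ∷ [])     = v⊮α v⊩α
⊩-bigOr⇒¬All¬ {αs = _ ∷ _ ∷ _} v⊩∨ (v⊮α ∷ v⊮rest) =
  v⊩∨ (v⊮α , λ v⊩rest → ⊩-bigOr⇒¬All¬ v⊩rest v⊮rest)

⊩-bigOr-chi⇔∈ : {v : Val k} {ws : List (Val k)} → v ⊩ bigOr (map chi ws) ⇔ v ∈ ws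
⊩-bigOr-chi⇔∈ {v = v} {ws} = mk⇔
  -- ⋎ is a double-negated disjunction; decidable membership removes the ¬¬.
  (λ v⊩∨ → decidable-stable (Any.any? (≡-dec _≟ᵇ_ v) ws) (⊩-bigOr⇒¬All¬ v⊩∨ ∘ map⁺ ∘ v∉⇒⊮χ))
  (λ v∈ws → ⊩-bigOr⁺ (∈-map⁺ chi v∈ws) (from ⊩-chi⇔≡ refl))
  where
  v∉⇒⊮χ : v ∉ ws → All (λ w → ¬ v ⊩ chi w) ws
  v∉⇒⊮χ v∉ws = All.tabulate λ w∈ws v⊩χ → v∉ws (subst (_∈ ws) (sym (to ⊩-chi⇔≡ v⊩χ)) w∈ws)

⊨-bigAnd⇔All : {t : Team k} {φs : List (Form k)} → t ⊨ bigAnd φs ⇔ All (t ⊨_) φs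
⊨-bigAnd⇔All = mk⇔ ⇒ ⇐
  where
  ⇒ : ∀ {t φs} → t ⊨ bigAnd φs → All (t ⊨_) φs
  ⇒ {φs = []}        _           = []
  ⇒ {φs = _ ∷ []}    t⊨φ         = t⊨φ ∷ []
  ⇒ {φs = _ ∷ _ ∷ _} (t⊨φ , t⊨φs) = t⊨φ ∷ ⇒ t⊨φs

  ⇐ : ∀ {t φs} → All (t ⊨_) φs → t ⊨ bigAnd φs
  ⇐ []                    = lift tt
  ⇐ (t⊨φ ∷ [])            = t⊨φ
  ⇐ (t⊨φ ∷ t⊨φs@(_ ∷ _)) = t⊨φ , ⇐ t⊨φs

⊨◇cl⇔ : {t : Team k} {α : CForm k} → t ⊨ dia (cl α) ⇔ ∃ λ v → t v × v ⊩ α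
⊨◇cl⇔ = mk⇔
  (λ (s , s⊆t , (v , sv) , lift s⊨α) → v , s⊆t v sv , s⊨α v sv)
  (λ (v , tv , v⊩α) →
    (_≡ v) , (λ { _ refl → tv }) , (v , refl) , lift (λ { _ refl → v⊩α }))

⊨◇bigOr-chi⇔Any : {t : Team k} {ws : List (Val k)} →
  t ⊨ dia (cl (bigOr (map chi ws))) ⇔ Any t ws
⊨◇bigOr-chi⇔Any = mk⇔
  (λ t⊨◇ → let v , tv , v⊩∨ = to ⊨◇cl⇔ t⊨◇ in lose (to ⊩-bigOr-chi⇔∈ v⊩∨) tv)
  (λ hit → let v , v∈ws , tv = find hit in from ⊨◇cl⇔ (v , tv , from ⊩-bigOr-chi⇔∈ v∈ws))

All-⊎-factorˡ : {a b c : Level} {A : Set a} {B : Set b} {C : Pred A c} {xs : List A} →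
  All (λ x → B ⊎ C x) xs → B ⊎ All C xs
All-⊎-factorˡ []                = inj₂ []
All-⊎-factorˡ (inj₁ b  ∷ _)     = inj₁ b
All-⊎-factorˡ (inj₂ cx ∷ rest) with All-⊎-factorˡ rest
... | inj₁ b   = inj₁ b
... | inj₂ cxs = inj₂ (cx ∷ cxs)

module _ {p : Level} {A : Set} where

  All-choices-∷⇔ : {Q : Pred (List A) p} {xs : List A} {xss : List (List A)} →
    All Q (choices (xs ∷ xss)) ⇔ All (λ x → All (Q ∘ (x ∷_)) (choices xss)) xs
  All-choices-∷⇔ = mk⇔ (All.map map⁻ ∘ map⁻ ∘ concat⁻) (concat⁺ ∘ map⁺ ∘ All.map map⁺)

  module _ {T : Pred A p} where

    All-Any-choices⇒Any-All : {xss : List (List A)} → All (Any T) (choices xss) → Any (All T) xss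
    All-Any-choices⇒Any-All {[]} (() ∷ [])
    All-Any-choices⇒Any-All {xs ∷ xss} hits
      with All-⊎-factorˡ (All.map hitsRestOrHead (to (All-choices-∷⇔ {xss = xss}) hits))
      where
      hitsRestOrHead : ∀ {x} → All (Any T ∘ (x ∷_)) (choices xss) → All (Any T) (choices xss) ⊎ T x
      hitsRestOrHead = swap ∘ All-⊎-factorˡ ∘ All.map Any.toSum
    ... | inj₁ hitsRest = there (All-Any-choices⇒Any-All hitsRest)
    ... | inj₂ xs⊆T     = here xs⊆T

    Any-All⇒All-Any-choices : {xss : List (List A)} → Any (All T) xss → All (Any T) (choices xss)
    Any-All⇒All-Any-choices {xs ∷ xss} (here xs⊆T) =
      from (All-choices-∷⇔ {xss = xss})
        (All.tabulate λ x∈xs → All.universal (λ _ → here (All.lookup xs⊆T x∈xs)) (choices xss))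
    Any-All⇒All-Any-choices {xs ∷ xss} (there some) =
      from (All-choices-∷⇔ {xss = xss})
        (All.universal (λ _ → All.map there (Any-All⇒All-Any-choices some)) xs)

    All-Any-choices⇔Any-All : {xss : List (List A)} → All (Any T) (choices xss) ⇔ Any (All T) xss
    All-Any-choices⇔Any-All = mk⇔ All-Any-choices⇒Any-All Any-All⇒All-Any-choices

Any-All⇔∃⊆ : {p : Level} {A : Set} {T : Pred A p} {xss : List (List A)} →
  Any (All T) xss ⇔ Σ (List A) (λ xs → (xs ∈ xss) × (∀ x → x ∈ xs → T x))
Any-All⇔∃⊆ = mk⇔
  (λ some → let xs , xs∈ , xs⊆T = find some in xs , xs∈ , λ _ → All.lookup xs⊆T)
  (λ (xs , xs∈ , xs⊆T) → lose xs∈ (All.tabulate (xs⊆T _)))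

lemma2p10 : (k : ℕ) (P : List (List (Val k))) → P ≢ [] → (t : Team k) →
    (t ⊨ chiU P) ⇔ Σ (List (Val k)) (λ ti → (ti ∈ P) × (∀ v → v ∈ ti → t v))
lemma2p10 k P _ t = begin
  t ⊨ chiU P
    ∼⟨ ⊨-bigAnd⇔All ⟩
  All (t ⊨_) (map (λ vs → dia (cl (bigOr (map chi vs)))) (choices P))
    ∼⟨ mk⇔ map⁻ map⁺ ⟩
  All (λ vs → t ⊨ dia (cl (bigOr (map chi vs)))) (choices P)
    ∼⟨ mk⇔ (All.map (to ⊨◇bigOr-chi⇔Any)) (All.map (from ⊨◇bigOr-chi⇔Any)) ⟩
  All (Any t) (choices P)
    ∼⟨ All-Any-choices⇔Any-All ⟩
  Any (All t) P
    ∼⟨ Any-All⇔∃⊆ ⟩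
  Σ (List (Val k)) (λ ti → (ti ∈ P) × (∀ v → v ∈ ti → t v))
    ∎
  where open EquationalReasoning
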